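{- Let $\mathcal{M}^k_*=(E_*,\mathcal{I}^k_*)$ be the extended $k$-fold union of a matroid $\mathcal{M}=(E,\mathcal{I})$, let $(e,i)\in E_*$ and $S\subseteq E_*$. If $\mathrm{occ}_e(S)<k$, then $(e,i)\notin\mathrm{Span}(S\setminus\{(e,i)\})$, where the span is taken in $\mathcal{M}^k_*$.
   Context: $E_*=E\times[k]$ and $\mathcal{M}_*=(E_*,\mathcal{I}_*)$ is the matroid in which $\{(e_1,i_1),\dots,(e_t,i_t)\}$ is independent iff $e_1,\dots,e_t$ are distinct and $\{e_1,\dots,e_t\}\in\mathcal{I}$ ($k$ parallel copies of each element). $\mathcal{M}^k_*$ is the $k$-fold union of $\mathcal{M}_*$: independent sets are unions of $k$ independent sets of $\mathcal{M}_*$. Let $\mathrm{rank}$ denote the rank function of $\mathcal{M}^k_*$ and $\mathrm{Span}(S)=\{a\in E_*:\mathrm{rank}(S\cup\{a\})=\mathrm{rank}(S)\}$. For $e\in E$, $\mathrm{occ}_e(S)=k-\mathrm{rank}(S\cup(\{e\}\times[k]))+\mathrm{rank}(S)$. -}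

module Defs where

open import Data.Nat using (ℕ; zero; suc; _+_; _*_; _∸_; _<_; _≤_)
open import Data.Fin using (Fin; zero; suc; combine; quotient; _≟_)
open import Data.Fin.Subset using (Subset; _∈_; _∉_; _⊆_; _∪_; ⁅_⁆; ∣_∣; ⊥)
open import Data.Vec using (tabulate)
open import Data.Bool using (Bool; true; false; _∨_)
open import Data.Product using (Σ; ∃; ∃-syntax; _×_; _,_)
open import Relation.Nullary.Decidable using (⌊_⌋)
open import Relation.Binary.PropositionalEquality using (_≡_)
open import Function.Bundles using (_⇔_)

record Matroid (n : ℕ) : Set₁ where
  field
    Indep        : Subset n → Set
    indep-empty  : Indep ⊥
    indep-subset : ∀ {X Y} → Y ⊆ X → Indep X → Indep Y
    indep-exch   : ∀ {X Y} → Indep X → Indep Y → ∣ X ∣ < ∣ Y ∣ →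
                   ∃[ y ] (y ∈ Y × y ∉ X × Indep (X ∪ ⁅ y ⁆))
open Matroid public

-- E_* = E × [k] is encoded as Fin (n * k); the pair (e , i) is  combine e i ,
-- and the E-coordinate of x : Fin (n * k) is  quotient k x .

anyFin : ∀ {k} → (Fin k → Bool) → Bool
anyFin {zero}  f = false
anyFin {suc k} f = f zero ∨ anyFin (λ i → f (suc i))

image : ∀ {n} k → Subset (n * k) → Subset n
image k T = tabulate (λ e → anyFin (λ i → Data.Vec.lookup T (combine e i)))
  where import Data.Vec

copies : ∀ {n} k → Fin n → Subset (n * k)
copies {n} k e = tabulate (λ x → ⌊ quotient {n} k x ≟ e ⌋)

IndepStar : ∀ {n} (M : Matroid n) k → Subset (n * k) → Set
IndepStar {n} M k T =
  (∀ x y → x ∈ T → y ∈ T → quotient {n} k x ≡ quotient {n} k y → x ≡ y)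
  × Indep M (image k T)

IndepUnion : ∀ {n} (M : Matroid n) k → Subset (n * k) → Set
IndepUnion {n} M k T =
  Σ (Fin k → Subset (n * k)) λ P →
    (∀ j → IndepStar M k (P j)) × (∀ x → (x ∈ T) ⇔ (∃[ j ] x ∈ P j))

IsRank : ∀ {n} (M : Matroid n) k → Subset (n * k) → ℕ → Set
IsRank M k S r =
  (∃[ T ] (T ⊆ S × IndepUnion M k T × ∣ T ∣ ≡ r))
  × (∀ T → T ⊆ S → IndepUnion M k T → ∣ T ∣ ≤ r)

InSpan : ∀ {n} (M : Matroid n) k → Subset (n * k) → Fin (n * k) → Set
InSpan M k S a = ∃[ r ] (IsRank M k S r × IsRank M k (S ∪ ⁅ a ⁆) r)

IsOcc : ∀ {n} (M : Matroid n) k → Fin n → Subset (n * k) → ℕ → Set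
IsOcc M k e S o = ∃[ r₀ ] ∃[ r₁ ]
  (IsRank M k S r₀ × IsRank M k (S ∪ copies k e) r₁ × o ≡ (k + r₀) ∸ r₁)

module Submission where

-- The k-fold union of a matroid satisfies the exchange axiom: colour two independent sets T, U
-- with |T| < |U| by decompositions into k independent sets; by pigeonhole some colour class of T
-- is smaller than that of U, and exchange in that class adds an element x of U.  If x already lies
-- in T it is merely recoloured, after which the two colourings agree at one more point, so the
-- process stops with x ∉ T.
--
-- For the lemma let a = (e,i), T a maximum independent subset of S − a and U one of
-- S ∪ ({e} × [k]).  occ_e(S) < k says rank S < rank (S ∪ ({e} × [k])), so |T| < |U| and T extends
-- by some x ∈ U.  A copy x of e may be traded for its parallel copy a; otherwise x ∈ S − a.  Either
-- way T gains an element of (S − a) ∪ {a} and stays independent, so rank((S − a) ∪ {a}) > rank(S − a).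

open import Defs
open import Data.Nat using (ℕ; zero; suc; _+_; _*_; _∸_; _≤_; _<_; z≤n)
open import Data.Nat.Properties
  using ( _<?_; +-assoc; +-suc; +-identityʳ; +-∸-assoc; +-mono-≤; +-monoˡ-≤; ≤-reflexive; ≤-trans
        ; <-≤-trans; <⇒≱; ≮⇒≥; ≰⇒>; n<1+n; n≮0; m≤m+n; m≤n+m; +-0-commutativeMonoid; module ≤-Reasoning)
open import Data.Bool using (Bool; true; false; if_then_else_; _∧_; _∨_)
open import Data.Bool.Properties using (∨-zeroʳ)
open import Data.Fin using (Fin; zero; suc; _↑ˡ_; _↑ʳ_; combine; quotient; remainder; _≟_)
open import Data.Fin.Properties
  using (any?; suc-injective; remQuot-combine; combine-remQuot; combine-injectiveʳ)
open import Data.Product using (Σ; ∃; ∃-syntax; _×_; _,_; proj₁; proj₂)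
open import Data.Vec using ([]; _∷_; lookup; tabulate; there)
open import Data.Vec.Properties using ([]=⇒lookup; lookup⇒[]=; lookup∘tabulate; lookup-zipWith)
open import Data.Fin.Subset using (Subset; _∈_; _∉_; _⊆_; _⊂_; _-_; _∪_; _∩_; ⁅_⁆; ∣_∣)
open import Data.Fin.Subset.Properties
  using ( _∈?_; ∉⊥; x∈⁅x⁆; x∈⁅y⁆⇒x≡y; x∈p∪q⁺; x∈p∪q⁻; x∈p∩q⁺; x∈p∩q⁻; x∈p∧x≢y⇒x∈p-y
        ; ⊆-refl; ⊆-trans; p⊆p∪q; p─q⊆p; ∣p∣≤n; ∣⊥∣≡0; p⊂q⇒∣p∣<∣q∣; nonempty?; Empty-unique)
open import Data.Sum using (_⊎_; inj₁; inj₂; [_,_]′)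
open import Data.Vec.Functional using (updateAt)
open import Data.Vec.Functional.Properties using (updateAt-updates; updateAt-minimal)
open import Function.Bundles using (_⇔_; mk⇔; Equivalence)
open import Function using (_∘_; id; const)
open import Relation.Nullary using (¬_; Dec; yes; no)
open import Relation.Nullary.Decidable using (⌊_⌋; ⌊⌋-map′; dec-true; isYes≗does)
open import Relation.Nullary.Negation using (contradiction; ¬∃⟶∀¬)
open import Relation.Binary.PropositionalEquality
open import Algebra.Properties.CommutativeMonoid.Sum +-0-commutativeMonoid
  using (sum; sum-syntax; ∑-comm; sum-cong-≗; sum-replicate-zero)

m+n∸o<m⇒n<o : ∀ m {n o} → m + n ∸ o < m → n < o
m+n∸o<m⇒n<o m {n} {o} lt =
  ≰⇒> (λ o≤n → <⇒≱ lt (≤-trans (m≤m+n m (n ∸ o)) (≤-reflexive (sym (+-∸-assoc m o≤n)))))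

indicator : Bool → ℕ
indicator b = if b then 1 else 0

∑-mono-≤ : ∀ {m} {f g : Fin m → ℕ} → (∀ i → f i ≤ g i) → sum f ≤ sum g
∑-mono-≤ {zero}  f≤g = z≤n
∑-mono-≤ {suc m} f≤g = +-mono-≤ (f≤g zero) (∑-mono-≤ (f≤g ∘ suc))

∑-<⇒∃-< : ∀ {m} {f g : Fin m → ℕ} → sum f < sum g → ∃[ i ] f i < g i
∑-<⇒∃-< {f = f} {g} ∑f<∑g with any? (λ i → f i <? g i)
... | yes f<g = f<g
... | no ¬f<g = contradiction (∑-mono-≤ (λ i → ≮⇒≥ (¬∃⟶∀¬ ¬f<g i))) (<⇒≱ ∑f<∑g)

∑-↑ : ∀ a {b} (f : Fin (a + b) → ℕ) → sum f ≡ sum (f ∘ (_↑ˡ b)) + sum (f ∘ (a ↑ʳ_))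
∑-↑ zero    f = refl
∑-↑ (suc a) f = trans (cong (f zero +_) (∑-↑ a (f ∘ suc))) (sym (+-assoc (f zero) _ _))

∑-combine : ∀ n {k} (f : Fin (n * k) → ℕ) → sum f ≡ ∑[ e < n ] ∑[ i < k ] f (combine e i)
∑-combine zero    f = refl
∑-combine (suc n) {k} f =
  trans (∑-↑ k f) (cong (sum (f ∘ (_↑ˡ n * k)) +_) (∑-combine n (f ∘ (k ↑ʳ_))))

∑-indicator-≟ : ∀ {l} (c : Fin l) → ∑[ j < l ] indicator ⌊ c ≟ j ⌋ ≡ 1
∑-indicator-≟ {suc l} zero    = cong suc (sum-replicate-zero l)
∑-indicator-≟ {suc l} (suc c) =
  trans (sum-cong-≗ (λ j → cong indicator (⌊⌋-map′ _ _ (c ≟ j)))) (∑-indicator-≟ c)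

anyFin⁺ : ∀ {k} (g : Fin k → Bool) {i} → g i ≡ true → anyFin g ≡ true
anyFin⁺ g {zero}  gi = cong (_∨ anyFin (g ∘ suc)) gi
anyFin⁺ g {suc i} gi = trans (cong (g zero ∨_) (anyFin⁺ (g ∘ suc) gi)) (∨-zeroʳ (g zero))

anyFin⁻ : ∀ {k} (g : Fin k → Bool) → anyFin g ≡ true → ∃[ i ] g i ≡ true
anyFin⁻ {suc k} g any≡true with g zero in g0
... | true  = zero , g0
... | false = let i , gi = anyFin⁻ (g ∘ suc) any≡true in suc i , gi

∑-indicator-anyFin : ∀ {k} (g : Fin k → Bool) → (∀ i i′ → g i ≡ true → g i′ ≡ true → i ≡ i′) →
                     ∑[ i < k ] indicator (g i) ≡ indicator (anyFin g)
∑-indicator-anyFin {zero}  g unique = refl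
∑-indicator-anyFin {suc k} g unique with g zero in g0
... | true  = cong suc (trans (sum-cong-≗ rest-false) (sum-replicate-zero k))
  where
  rest-false : ∀ i → indicator (g (suc i)) ≡ 0
  rest-false i with g (suc i) in gi
  ... | true  = contradiction (unique zero (suc i) g0 gi) λ ()
  ... | false = refl
... | false =
  ∑-indicator-anyFin (g ∘ suc) (λ i i′ gi gi′ → suc-injective (unique (suc i) (suc i′) gi gi′))

∈-tabulate⁺ : ∀ {m} {f : Fin m → Bool} {x} → f x ≡ true → x ∈ tabulate f
∈-tabulate⁺ {f = f} {x} fx = lookup⇒[]= x (tabulate f) (trans (lookup∘tabulate f x) fx)

∈-tabulate⁻ : ∀ {m} {f : Fin m → Bool} {x} → x ∈ tabulate f → f x ≡ true
∈-tabulate⁻ {f = f} {x} x∈ = trans (sym (lookup∘tabulate f x)) ([]=⇒lookup x∈)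

∣p∣≡∑ : ∀ {m} (p : Subset m) → ∣ p ∣ ≡ ∑[ x < m ] indicator (lookup p x)
∣p∣≡∑ []          = refl
∣p∣≡∑ (true ∷ p)  = cong suc (∣p∣≡∑ p)
∣p∣≡∑ (false ∷ p) = ∣p∣≡∑ p

∣p∣<∣p∪⁅x⁆∣ : ∀ {m} {p : Subset m} {x} → x ∉ p → ∣ p ∣ < ∣ p ∪ ⁅ x ⁆ ∣
∣p∣<∣p∪⁅x⁆∣ {p = p} {x} x∉p = p⊂q⇒∣p∣<∣q∣ (p⊆p∪q ⁅ x ⁆ , x , x∈p∪q⁺ (inj₂ (x∈⁅x⁆ x)) , x∉p)

x∉p-x : ∀ {m} (p : Subset m) x → x ∉ p - x
x∉p-x (_ ∷ p) zero    ()
x∉p-x (_ ∷ p) (suc x) (there x∈) = x∉p-x p x x∈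

∪⁅⁆-⊆ : ∀ {m} {p q : Subset m} {x} → p ⊆ q → x ∈ q → p ∪ ⁅ x ⁆ ⊆ q
∪⁅⁆-⊆ {p = p} {q} {x} p⊆q x∈q y∈ with x∈p∪q⁻ p _ y∈
... | inj₁ y∈p = p⊆q y∈p
... | inj₂ y∈x = subst (_∈ q) (sym (x∈⁅y⁆⇒x≡y x y∈x)) x∈q

equaliser : ∀ {m l} → (Fin m → Fin l) → (Fin m → Fin l) → Subset m
equaliser c c′ = tabulate (λ y → ⌊ c y ≟ c′ y ⌋)

∈-equaliser⁺ : ∀ {m l} {c c′ : Fin m → Fin l} {y} → c y ≡ c′ y → y ∈ equaliser c c′
∈-equaliser⁺ {c = c} {c′} {y} cy≡c′y =
  ∈-tabulate⁺ (trans (isYes≗does (c y ≟ c′ y)) (dec-true (c y ≟ c′ y) cy≡c′y))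

∈-equaliser⁻ : ∀ {m l} {c c′ : Fin m → Fin l} {y} → y ∈ equaliser c c′ → c y ≡ c′ y
∈-equaliser⁻ {c = c} {c′} {y} y∈ with c y ≟ c′ y | ∈-tabulate⁻ {f = λ y → ⌊ c y ≟ c′ y ⌋} y∈
... | yes cy≡c′y | _ = cy≡c′y

fibre : ∀ {m l} → (Fin m → Fin l) → Fin l → Subset m
fibre c j = equaliser c (const j)

∣p∣≡∑∣p∩fibre∣ : ∀ {m l} (p : Subset m) (c : Fin m → Fin l) → ∣ p ∣ ≡ ∑[ j < l ] ∣ p ∩ fibre c j ∣
∣p∣≡∑∣p∩fibre∣ {m} {l} p c = begin
  ∣ p ∣
    ≡⟨ ∣p∣≡∑ p ⟩
  ∑[ x < m ] indicator (lookup p x)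
    ≡⟨ sum-cong-≗ split ⟨
  ∑[ x < m ] ∑[ j < l ] indicator (lookup (p ∩ fibre c j) x)
    ≡⟨ ∑-comm (λ x j → indicator (lookup (p ∩ fibre c j) x)) ⟩
  ∑[ j < l ] ∑[ x < m ] indicator (lookup (p ∩ fibre c j) x)
    ≡⟨ sum-cong-≗ (λ j → ∣p∣≡∑ (p ∩ fibre c j)) ⟨
  ∑[ j < l ] ∣ p ∩ fibre c j ∣
    ∎
  where
  open ≡-Reasoning
  lookup-class : ∀ x j → lookup (p ∩ fibre c j) x ≡ lookup p x ∧ ⌊ c x ≟ j ⌋
  lookup-class x j = trans (lookup-zipWith _∧_ x p _) (cong (lookup p x ∧_) (lookup∘tabulate _ x))
  split : ∀ x → ∑[ j < l ] indicator (lookup (p ∩ fibre c j) x) ≡ indicator (lookup p x)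
  split x rewrite sum-cong-≗ (λ j → cong indicator (lookup-class x j)) with lookup p x
  ... | true  = ∑-indicator-≟ (c x)
  ... | false = sum-replicate-zero l

module KFoldUnion {m} (N : Matroid m) (k : ℕ) where

  Union : Subset m → Set
  Union T = Σ (Fin k → Subset m) λ P →
    (∀ j → Indep N (P j)) × (∀ x → (x ∈ T) ⇔ (∃[ j ] x ∈ P j))

  Colouring : Subset m → (Fin m → Fin k) → Set
  Colouring T c = ∀ j → Indep N (T ∩ fibre c j)

  Colouring-⊆ : ∀ {T T′ c} → T′ ⊆ T → Colouring T c → Colouring T′ c
  Colouring-⊆ {T} {T′} T′⊆T colT j =
    indep-subset N (λ {y} y∈ → let y∈T′ , y∈c = x∈p∩q⁻ T′ _ y∈ in x∈p∩q⁺ (T′⊆T y∈T′ , y∈c)) (colT j)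

  colouring⇒union : ∀ {T c} → Colouring T c → Union T
  colouring⇒union {T} {c} colT = (λ j → T ∩ fibre c j) , colT ,
    λ x → mk⇔ (λ x∈T → c x , x∈p∩q⁺ (x∈T , ∈-equaliser⁺ refl))
              (λ { (j , x∈) → proj₁ (x∈p∩q⁻ T _ x∈) })

  colourOf : ∀ {T x} → Union T → x ∈ T → Fin k
  colourOf (_ , _ , T⇔∪P) x∈T = proj₁ (Equivalence.to (T⇔∪P _) x∈T)

  -- points outside T receive the junk colour d
  union⇒colouring : ∀ {T} → Fin k → Union T → ∃ (Colouring T)
  union⇒colouring {T} d (P , indP , T⇔∪P) = colour , colT
    where
    pick : ∀ {x} → Dec (∃[ j ] x ∈ P j) → Fin k
    pick (yes (j , _)) = j
    pick (no _)        = d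
    pick-∈ : ∀ {x} (x∈P? : Dec (∃[ j ] x ∈ P j)) → ∃[ j ] x ∈ P j → x ∈ P (pick x∈P?)
    pick-∈ (yes (j , x∈Pj)) _ = x∈Pj
    pick-∈ (no x∉P)         x∈P = contradiction x∈P x∉P
    colour : Fin m → Fin k
    colour x = pick (any? (λ j → x ∈? P j))
    colT : Colouring T colour
    colT j = indep-subset N class⊆Pj (indP j)
      where
      class⊆Pj : T ∩ fibre colour j ⊆ P j
      class⊆Pj {y} y∈ with x∈p∩q⁻ T _ y∈
      ... | y∈T , y∈c = subst (λ i → y ∈ P i) (∈-equaliser⁻ y∈c)
                              (pick-∈ (any? (λ j → y ∈? P j)) (Equivalence.to (T⇔∪P y) y∈T))

  recolour : (Fin m → Fin k) → Fin m → Fin k → Fin m → Fin k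
  recolour c x j = updateAt c x (const j)

  recoloured-class : ∀ {T T′ c x j j′ y} → T′ ⊆ T ∪ ⁅ x ⁆ → y ∈ T′ ∩ fibre (recolour c x j) j′ →
                     (y ≡ x × j ≡ j′) ⊎ y ∈ T ∩ fibre c j′
  recoloured-class {T} {T′} {c} {x} {j} {j′} {y} T′⊆ y∈ with x∈p∩q⁻ T′ _ y∈ | y ≟ x
  ... | _ , y∈c | yes refl = inj₁ (refl , trans (sym (updateAt-updates x c)) (∈-equaliser⁻ y∈c))
  ... | y∈T′ , y∈c | no y≢x with x∈p∪q⁻ T ⁅ x ⁆ (T′⊆ y∈T′)
  ...   | inj₁ y∈T =
    inj₂ (x∈p∩q⁺ (y∈T , ∈-equaliser⁺ (trans (sym (updateAt-minimal y x c y≢x)) (∈-equaliser⁻ y∈c))))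
  ...   | inj₂ y∈x = contradiction (x∈⁅y⁆⇒x≡y x y∈x) y≢x

  Colouring-recolour : ∀ {T T′ c x j} → Colouring T c → Indep N ((T ∩ fibre c j) ∪ ⁅ x ⁆) →
                       T′ ⊆ T ∪ ⁅ x ⁆ → Colouring T′ (recolour c x j)
  Colouring-recolour {T} {T′} {c} {x} {j} colT indx T′⊆ j′ with j ≟ j′
  ... | yes refl = indep-subset N (λ y∈ → [ (λ { (refl , _) → x∈p∪q⁺ (inj₂ (x∈⁅x⁆ x)) })
                                           , (λ y∈Tj → x∈p∪q⁺ (inj₁ y∈Tj)) ]′ (recoloured-class T′⊆ y∈)) indx
  ... | no j≢j′  = indep-subset N (λ y∈ → [ (λ { (_ , j≡j′) → contradiction j≡j′ j≢j′ }) , id ]′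
                                            (recoloured-class T′⊆ y∈)) (colT j′)

  equaliser-recolour : ∀ {c c′ : Fin m → Fin k} {x j} → c′ x ≡ j → c x ≢ j →
                       equaliser c c′ ⊂ equaliser (recolour c x j) c′
  equaliser-recolour {c} {c′} {x} {j} c′x≡j cx≢j = agree⊆ , x , x∈new , x∉old
    where
    agree⊆ : equaliser c c′ ⊆ equaliser (recolour c x j) c′
    agree⊆ {y} y∈ with y ≟ x | ∈-equaliser⁻ y∈
    ... | yes refl | cx≡c′x = contradiction (trans cx≡c′x c′x≡j) cx≢j
    ... | no y≢x   | cy≡c′y = ∈-equaliser⁺ (trans (updateAt-minimal y x c y≢x) cy≡c′y)
    x∈new : x ∈ equaliser (recolour c x j) c′
    x∈new = ∈-equaliser⁺ (trans (updateAt-updates x c) (sym c′x≡j))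
    x∉old : x ∉ equaliser c c′
    x∉old x∈ = cx≢j (trans (∈-equaliser⁻ x∈) c′x≡j)

  Augmentation : Subset m → Subset m → Set
  Augmentation T U = ∃[ x ] (x ∈ U × x ∉ T × ∃ (Colouring (T ∪ ⁅ x ⁆)))

  augment-with-fuel : ∀ {T U cu} → Colouring U cu → ∣ T ∣ < ∣ U ∣ →
                   ∀ fuel ct → Colouring T ct → m < ∣ equaliser ct cu ∣ + fuel → Augmentation T U
  augment-with-fuel {cu = cu} colU ∣T∣<∣U∣ zero ct colT bound =
    contradiction (≤-trans (≤-reflexive (+-identityʳ _)) (∣p∣≤n (equaliser ct cu))) (<⇒≱ bound)
  augment-with-fuel {T} {U} {cu} colU ∣T∣<∣U∣ (suc fuel) ct colT bound
    with ∑-<⇒∃-< (subst₂ _<_ (∣p∣≡∑∣p∩fibre∣ T ct) (∣p∣≡∑∣p∩fibre∣ U cu) ∣T∣<∣U∣)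
  ... | j , ∣Tj∣<∣Uj∣ with indep-exch N (colT j) (colU j) ∣Tj∣<∣Uj∣
  ... | x , x∈Uj , x∉Tj , indTjx with x ∈? T
  ... | no x∉T  =
    x , proj₁ (x∈p∩q⁻ U _ x∈Uj) , x∉T , recolour ct x j , Colouring-recolour colT indTjx ⊆-refl
  ... | yes x∈T =
    augment-with-fuel colU ∣T∣<∣U∣ fuel (recolour ct x j)
                      (Colouring-recolour colT indTjx (p⊆p∪q _)) bound′
    where
    grows : ∣ equaliser ct cu ∣ < ∣ equaliser (recolour ct x j) cu ∣
    grows = p⊂q⇒∣p∣<∣q∣ (equaliser-recolour (∈-equaliser⁻ (proj₂ (x∈p∩q⁻ U _ x∈Uj)))
                                            (λ ctx≡j → x∉Tj (x∈p∩q⁺ (x∈T , ∈-equaliser⁺ ctx≡j))))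
    bound′ : m < ∣ equaliser (recolour ct x j) cu ∣ + fuel
    bound′ = <-≤-trans bound (≤-trans (≤-reflexive (+-suc _ fuel)) (+-monoˡ-≤ fuel grows))

  augment : ∀ {T U ct cu} → Colouring T ct → Colouring U cu → ∣ T ∣ < ∣ U ∣ → Augmentation T U
  augment colT colU ∣T∣<∣U∣ =
    augment-with-fuel colU ∣T∣<∣U∣ (suc m) _ colT (≤-trans (n<1+n m) (m≤n+m (suc m) _))

  union-exch : ∀ {T U} → Union T → Union U → ∣ T ∣ < ∣ U ∣ → ∃[ x ] (x ∈ U × x ∉ T × Union (T ∪ ⁅ x ⁆))
  union-exch {T} {U} indT indU ∣T∣<∣U∣ with nonempty? U
  ... | no U-empty = contradiction (subst (∣ T ∣ <_) ∣U∣≡0 ∣T∣<∣U∣) n≮0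
    where
    ∣U∣≡0 : ∣ U ∣ ≡ 0
    ∣U∣≡0 = trans (cong ∣_∣ (Empty-unique U-empty)) (∣⊥∣≡0 m)
  ... | yes (y , y∈U) =
    let d = colourOf indU y∈U
        ct , colT = union⇒colouring d indT
        cu , colU = union⇒colouring d indU
        x , x∈U , x∉T , _ , colTx = augment colT colU ∣T∣<∣U∣
    in x , x∈U , x∉T , colouring⇒union colTx

  union-replace : ∀ {T x a} → (∀ {P} → x ∉ P → Indep N (P ∪ ⁅ x ⁆) → Indep N (P ∪ ⁅ a ⁆)) →
                  x ∉ T → Union (T ∪ ⁅ x ⁆) → Union (T ∪ ⁅ a ⁆)
  union-replace {T} {x} {a} replace x∉T indTx
    with union⇒colouring (colourOf indTx (x∈p∪q⁺ (inj₂ (x∈⁅x⁆ x)))) indTx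
  ... | c , colTx = colouring⇒union (Colouring-recolour (Colouring-⊆ (p⊆p∪q _) colTx) indTa ⊆-refl)
    where
    Tx-class : (T ∩ fibre c (c x)) ∪ ⁅ x ⁆ ⊆ (T ∪ ⁅ x ⁆) ∩ fibre c (c x)
    Tx-class y∈ with x∈p∪q⁻ _ _ y∈
    ... | inj₁ y∈Tj with x∈p∩q⁻ T _ y∈Tj
    ...   | y∈T , y∈j = x∈p∩q⁺ (x∈p∪q⁺ (inj₁ y∈T) , y∈j)
    Tx-class y∈ | inj₂ y∈x rewrite x∈⁅y⁆⇒x≡y x y∈x = x∈p∩q⁺ (x∈p∪q⁺ (inj₂ (x∈⁅x⁆ x)) , ∈-equaliser⁺ refl)
    indTa : Indep N ((T ∩ fibre c (c x)) ∪ ⁅ a ⁆)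
    indTa = replace (λ x∈ → x∉T (proj₁ (x∈p∩q⁻ T _ x∈))) (indep-subset N Tx-class (colTx (c x)))

module ExtendedMatroid {n} (M : Matroid n) (k : ℕ) where

  base : Fin (n * k) → Fin n
  base = quotient {n} k

  img : Subset (n * k) → Subset n
  img = image {n} k

  base-combine : ∀ e i → base (combine e i) ≡ e
  base-combine e i = cong proj₁ (remQuot-combine {n} {k} e i)

  ∈-img⁺ : ∀ {T x} → x ∈ T → base x ∈ img T
  ∈-img⁺ {T} {x} x∈T = ∈-tabulate⁺ (anyFin⁺ _ {remainder {n} k x}
    (trans (cong (lookup T) (combine-remQuot {n} k x)) ([]=⇒lookup x∈T)))

  ∈-img⁻ : ∀ {T e} → e ∈ img T → ∃[ i ] combine e i ∈ T
  ∈-img⁻ {T} {e} e∈ =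
    let i , Tei = anyFin⁻ _ (∈-tabulate⁻ {f = λ e → anyFin (λ i → lookup T (combine e i))} e∈)
    in i , lookup⇒[]= _ T Tei

  ∈-img-combine : ∀ {T e i} → combine e i ∈ T → e ∈ img T
  ∈-img-combine {T} {e} {i} ei∈T = subst (_∈ img T) (base-combine e i) (∈-img⁺ ei∈T)

  img-mono : ∀ {X Y} → Y ⊆ X → img Y ⊆ img X
  img-mono Y⊆X e∈ = let i , ei∈Y = ∈-img⁻ e∈ in ∈-img-combine (Y⊆X ei∈Y)

  img-∪⁅⁆⊆ : ∀ {P x} → img (P ∪ ⁅ x ⁆) ⊆ img P ∪ ⁅ base x ⁆
  img-∪⁅⁆⊆ {P} {x} {e} e∈ with ∈-img⁻ e∈
  ... | i , ei∈ with x∈p∪q⁻ P _ ei∈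
  ...   | inj₁ ei∈P = x∈p∪q⁺ (inj₁ (∈-img-combine ei∈P))
  ...   | inj₂ ei∈x = x∈p∪q⁺ (inj₂ (subst (_∈ ⁅ base x ⁆)
                        (trans (cong base (sym (x∈⁅y⁆⇒x≡y x ei∈x))) (base-combine e i)) (x∈⁅x⁆ (base x))))

  img-∪⁅⁆⊇ : ∀ {P x} → img P ∪ ⁅ base x ⁆ ⊆ img (P ∪ ⁅ x ⁆)
  img-∪⁅⁆⊇ {P} {x} e∈ with x∈p∪q⁻ (img P) _ e∈
  ... | inj₁ e∈P = img-mono {P ∪ ⁅ x ⁆} (p⊆p∪q _) e∈P
  ... | inj₂ e∈x rewrite x∈⁅y⁆⇒x≡y (base x) e∈x = ∈-img⁺ {P ∪ ⁅ x ⁆} (x∈p∪q⁺ (inj₂ (x∈⁅x⁆ x)))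

  BaseInjective : Subset (n * k) → Set
  BaseInjective T = ∀ x y → x ∈ T → y ∈ T → base x ≡ base y → x ≡ y

  BaseInjective-∪⁅⁆ : ∀ {P x} → BaseInjective P → base x ∉ img P → BaseInjective (P ∪ ⁅ x ⁆)
  BaseInjective-∪⁅⁆ {P} {x} injP x∉P y z y∈ z∈ by≡bz with x∈p∪q⁻ P _ y∈ | x∈p∪q⁻ P _ z∈
  ... | inj₁ y∈P | inj₁ z∈P = injP y z y∈P z∈P by≡bz
  ... | inj₁ y∈P | inj₂ z∈x rewrite x∈⁅y⁆⇒x≡y x z∈x =
    contradiction (subst (_∈ img P) by≡bz (∈-img⁺ y∈P)) x∉P
  ... | inj₂ y∈x | inj₁ z∈P rewrite x∈⁅y⁆⇒x≡y x y∈x =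
    contradiction (subst (_∈ img P) (sym by≡bz) (∈-img⁺ z∈P)) x∉P
  ... | inj₂ y∈x | inj₂ z∈x = trans (x∈⁅y⁆⇒x≡y x y∈x) (sym (x∈⁅y⁆⇒x≡y x z∈x))

  ∣img∣≡∣T∣ : ∀ {T} → BaseInjective T → ∣ img T ∣ ≡ ∣ T ∣
  ∣img∣≡∣T∣ {T} injT = begin
    ∣ img T ∣
      ≡⟨ ∣p∣≡∑ (img T) ⟩
    ∑[ e < n ] indicator (lookup (img T) e)
      ≡⟨ sum-cong-≗ {n} (λ e → cong indicator (lookup∘tabulate _ e)) ⟩
    ∑[ e < n ] indicator (anyFin (λ i → lookup T (combine e i)))
      ≡⟨ sum-cong-≗ {n} (λ e → ∑-indicator-anyFin _ (fibre-unique e)) ⟨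
    ∑[ e < n ] ∑[ i < k ] indicator (lookup T (combine e i))
      ≡⟨ ∑-combine n {k} (indicator ∘ lookup T) ⟨
    ∑[ x < n * k ] indicator (lookup T x)
      ≡⟨ ∣p∣≡∑ T ⟨
    ∣ T ∣
      ∎
    where
    open ≡-Reasoning
    fibre-unique : ∀ e i i′ → lookup T (combine e i) ≡ true → lookup T (combine e i′) ≡ true → i ≡ i′
    fibre-unique e i i′ Tei Tei′ = combine-injectiveʳ e i e i′
      (injT _ _ (lookup⇒[]= _ T Tei) (lookup⇒[]= _ T Tei′)
            (trans (base-combine e i) (sym (base-combine e i′))))

  IndepStar-subset : ∀ {X Y} → Y ⊆ X → IndepStar M k X → IndepStar M k Y
  IndepStar-subset Y⊆X (injX , indX) =
    (λ x y x∈ y∈ → injX x y (Y⊆X x∈) (Y⊆X y∈)) , indep-subset M (img-mono Y⊆X) indX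

  IndepStar-exch : ∀ {P Q} → IndepStar M k P → IndepStar M k Q → ∣ P ∣ < ∣ Q ∣ →
                   ∃[ x ] (x ∈ Q × x ∉ P × IndepStar M k (P ∪ ⁅ x ⁆))
  IndepStar-exch {P} {Q} (injP , indP) (injQ , indQ) ∣P∣<∣Q∣
    with indep-exch M indP indQ (subst₂ _<_ (sym (∣img∣≡∣T∣ injP)) (sym (∣img∣≡∣T∣ injQ)) ∣P∣<∣Q∣)
  ... | e , e∈Q , e∉P , indPe with ∈-img⁻ e∈Q
  ... | i , x∈Q = combine e i , x∈Q , (λ x∈P → e∉P (∈-img-combine x∈P)) ,
                  BaseInjective-∪⁅⁆ injP (subst (_∉ img P) (sym (base-combine e i)) e∉P) ,
                  indep-subset M (subst (λ b → img (P ∪ ⁅ combine e i ⁆) ⊆ img P ∪ ⁅ b ⁆)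
                                        (base-combine e i) (img-∪⁅⁆⊆ {P})) indPe

  M* : Matroid (n * k)
  M* = record
    { Indep        = IndepStar M k
    ; indep-empty  = (λ x _ x∈⊥ → contradiction x∈⊥ ∉⊥) ,
                     indep-subset M (λ e∈ → contradiction (proj₂ (∈-img⁻ e∈)) ∉⊥) (indep-empty M)
    ; indep-subset = IndepStar-subset
    ; indep-exch   = IndepStar-exch
    }

  IndepStar-parallel : ∀ {P x a} → base x ≡ base a → x ∉ P →
                       IndepStar M k (P ∪ ⁅ x ⁆) → IndepStar M k (P ∪ ⁅ a ⁆)
  IndepStar-parallel {P} {x} {a} bx≡ba x∉P indPx@(injPx , indImgPx) =
    BaseInjective-∪⁅⁆ (proj₁ (IndepStar-subset (p⊆p∪q _) indPx)) ba∉P ,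
    indep-subset M (⊆-trans (img-∪⁅⁆⊆ {P})
                            (subst (λ b → img P ∪ ⁅ b ⁆ ⊆ img (P ∪ ⁅ x ⁆)) bx≡ba (img-∪⁅⁆⊇ {P}))) indImgPx
    where
    ba∉P : base a ∉ img P
    ba∉P ba∈P with ∈-img⁻ ba∈P
    ... | i , y∈P = x∉P (subst (_∈ P) (injPx _ x (p⊆p∪q _ y∈P) (x∈p∪q⁺ (inj₂ (x∈⁅x⁆ x)))
                                              (trans (base-combine _ i) (sym bx≡ba))) y∈P)

-- IndepUnion M k is KFoldUnion.Union M* k by definition.
module _ {n} (M : Matroid n) (k : ℕ) where
  open ExtendedMatroid M k
  open KFoldUnion M* k

  maximum-not-extendable : ∀ {X r T y} → IsRank M k X r → ∣ T ∣ ≡ r → y ∉ T → T ∪ ⁅ y ⁆ ⊆ X →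
                           ¬ IndepUnion M k (T ∪ ⁅ y ⁆)
  maximum-not-extendable (_ , maximum) ∣T∣≡r y∉T Ty⊆X indTy =
    <⇒≱ (subst (_< _) ∣T∣≡r (∣p∣<∣p∪⁅x⁆∣ y∉T)) (maximum _ Ty⊆X indTy)

  relocate-augmentation : ∀ {S T x} e i → T ⊆ S - combine e i → x ∈ S ∪ copies k e → x ∉ T →
                  IndepUnion M k (T ∪ ⁅ x ⁆) →
                  ∃[ y ] (y ∉ T × y ∈ (S - combine e i) ∪ ⁅ combine e i ⁆ × IndepUnion M k (T ∪ ⁅ y ⁆))
  relocate-augmentation {S} {T} {x} e i T⊆ x∈ x∉T indTx with base x ≟ e
  ... | yes bx≡e = a , (λ a∈T → x∉p-x S a (T⊆ a∈T)) , x∈p∪q⁺ (inj₂ (x∈⁅x⁆ a)) ,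
                   union-replace (IndepStar-parallel (trans bx≡e (sym (base-combine e i)))) x∉T indTx
    where a = combine e i
  ... | no bx≢e with x∈p∪q⁻ S (copies k e) x∈
  ...   | inj₁ x∈S = x , x∉T , x∈p∪q⁺ (inj₁ (x∈p∧x≢y⇒x∈p-y x∈S x≢a)) , indTx
    where
    x≢a : x ≢ combine e i
    x≢a x≡a = bx≢e (trans (cong base x≡a) (base-combine e i))
  ...   | inj₂ x∈copy = contradiction (∈-equaliser⁻ {c = base} x∈copy) bx≢e

lemma4p8 : ∀ {n} (M : Matroid n) (k : ℕ) (e : Fin n) (i : Fin k) (S : Subset (n * k)) (o : ℕ) →
    IsOcc M k e S o → o < k →
    ¬ InSpan M k (S - combine e i) (combine e i)
lemma4p8 M k e i S o (r₀ , r₁ , rankS , ((U , U⊆ , indU , ∣U∣≡r₁) , _) , o≡) o<k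
                     (r , ((T , T⊆ , indT , ∣T∣≡r) , _) , rankSa) =
  let x , x∈U , x∉T , indTx = union-exch indT indU ∣T∣<∣U∣
      y , y∉T , y∈ , indTy  = relocate-augmentation M k e i T⊆ (U⊆ x∈U) x∉T indTx
  in  maximum-not-extendable M k rankSa ∣T∣≡r y∉T (∪⁅⁆-⊆ (⊆-trans T⊆ (p⊆p∪q _)) y∈) indTy
  where
  open ExtendedMatroid M k
  open KFoldUnion M* k
  ∣T∣<∣U∣ : ∣ T ∣ < ∣ U ∣
  ∣T∣<∣U∣ = begin-strict
    ∣ T ∣ ≤⟨ proj₂ rankS T (⊆-trans T⊆ (p─q⊆p S _)) indT ⟩
    r₀    <⟨ m+n∸o<m⇒n<o k (subst (_< k) o≡ o<k) ⟩
    r₁    ≡⟨ ∣U∣≡r₁ ⟨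
    ∣ U ∣ ∎
    where open ≤-Reasoning
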